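{- Let $(L,\vee,\wedge)$ be a complete modular lattice. Then the poset $(L,\le)$ is strictly modular.
   Context: For a poset $(P,\le)$ and $A\subseteq P$, $L(A)=\{x\in P\mid x\le y \text{ for all } y\in A\}$ and $U(A)=\{x\in P\mid x\ge y\text{ for all }y\in A\}$; one writes $L(a,b)$ for $L(\{a,b\})$, $L(a,A)$ for $L(\{a\}\cup A)$, $L(A,B)$ for $L(A\cup B)$, $LU(A)$ for $L(U(A))$, and similarly. For $a\in P$ and $A\subseteq P$, $a\le A$ means $a\le y$ for all $y\in A$ and $A\le a$ means $y\le a$ for all $y\in A$. A poset $(P,\le)$ is strictly modular if for all $x,y,z\in P$ and $X,Z\subseteq P$: (1) if $x\le Z$ then $L(U(x,y),Z)=LU(x,L(y,Z))$; (2) if $L(X)\le z$ then $L(U(L(X),y),z)=LU(L(X),L(y,z))$. -}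

module Defs where

open import Level using (Level; suc)
open import Data.Product using (Σ; _×_)
open import Relation.Unary using (Pred; _∪_; _⊆_; ｛_｝)
open import Relation.Binary.Lattice.Bundles using (Lattice)
open import Relation.Binary.PropositionalEquality using (_≡_)
open import Data.Sum using (_⊎_)

module _ {ℓ : Level} (P : Lattice ℓ ℓ ℓ) where
  open Lattice P

  Lo : Pred Carrier ℓ → Pred Carrier ℓ
  Lo A x = ∀ y → A y → x ≤ y

  Up : Pred Carrier ℓ → Pred Carrier ℓ
  Up A x = ∀ y → A y → y ≤ x

  pair : Carrier → Carrier → Pred Carrier ℓ
  pair a b z = (z ≡ a) ⊎ (z ≡ b)

  _≤S_ : Carrier → Pred Carrier ℓ → Set ℓ
  a ≤S A = ∀ y → A y → a ≤ y

  _S≤_ : Pred Carrier ℓ → Carrier → Set ℓ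
  A S≤ a = ∀ y → A y → y ≤ a

  _≐_ : Pred Carrier ℓ → Pred Carrier ℓ → Set ℓ
  A ≐ B = (A ⊆ B) × (B ⊆ A)

  IsModular : Set ℓ
  IsModular = ∀ x y z → x ≤ z → (x ∨ (y ∧ z)) ≈ ((x ∨ y) ∧ z)

  IsComplete : Set (suc ℓ)
  IsComplete = (A : Pred Carrier ℓ) →
    Σ Carrier (λ s → Up A s × (∀ u → Up A u → s ≤ u)) ×
    Σ Carrier (λ i → Lo A i × (∀ l → Lo A l → l ≤ i))

  IsStrictlyModular : Set (suc ℓ)
  IsStrictlyModular =
    (∀ (x y : Carrier) (Z : Pred Carrier ℓ) → x ≤S Z →
        Lo (Up (pair x y) ∪ Z) ≐ Lo (Up (｛ x ｝ ∪ Lo (｛ y ｝ ∪ Z)))) ×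
    (∀ (y z : Carrier) (X : Pred Carrier ℓ) → Lo X S≤ z →
        Lo (Up (Lo X ∪ ｛ y ｝) ∪ ｛ z ｝) ≐ Lo (Up (Lo X ∪ Lo (pair y z))))

{-# OPTIONS --safe #-}
module Submission where

-- Relation.Unary's _≐_ unfolds to the same pair of inclusions as the one in Defs.
open import Defs hiding (_≐_)
open import Level using (Level)
open import Data.Product using (_,_; proj₁; proj₂)
open import Data.Sum as Sum using (inj₁; inj₂)
open import Relation.Binary.Lattice.Bundles using (Lattice)
open import Relation.Binary.PropositionalEquality using (refl) renaming (sym to ≡-sym)
open import Relation.Unary using (Pred; _∪_; _∩_; _≐_; ｛_｝)
open import Relation.Unary.Properties using (≐-sym)
open import Relation.Unary.Relation.Binary.Equality using (≐-setoid)
open import Relation.Unary.Algebra using (∩-cong)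

-- In a lattice the lower cone of a set with a meet is the principal ideal of that meet, and dually.
-- Each side of both conditions is thereby computed bottom-up to a principal ideal ↓ e, and the
-- two values of e agree by the modular law, the side condition providing the comparability it needs.

module _ {ℓ : Level} (P : Lattice ℓ ℓ ℓ) where
  open Lattice P renaming (refl to ≤-refl)
  open import Relation.Binary.Reasoning.Setoid (≐-setoid Carrier ℓ)

  ↓_ : Carrier → Pred Carrier ℓ
  ↓ a = _≤ a

  ↑_ : Carrier → Pred Carrier ℓ
  ↑ a = a ≤_

  variable
    a b m x y z : Carrier
    A B X Z : Pred Carrier ℓ

  ↓-cong : a ≈ b → ↓ a ≐ ↓ b
  ↓-cong a≈b = (λ x≤a → trans x≤a (reflexive a≈b)) , (λ x≤b → trans x≤b (reflexive (Eq.sym a≈b)))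

  ↓-∩ : ↓ a ∩ ↓ b ≐ ↓ (a ∧ b)
  ↓-∩ {a} {b} = (λ (x≤a , x≤b) → ∧-greatest x≤a x≤b)
              , (λ x≤a∧b → trans x≤a∧b (x∧y≤x a b) , trans x≤a∧b (x∧y≤y a b))

  ↑-∩ : ↑ a ∩ ↑ b ≐ ↑ (a ∨ b)
  ↑-∩ {a} {b} = (λ (a≤x , b≤x) → ∨-least a≤x b≤x)
              , (λ a∨b≤x → trans (x≤x∨y a b) a∨b≤x , trans (y≤x∨y a b) a∨b≤x)

  Lo-cong : A ≐ B → Lo P A ≐ Lo P B
  Lo-cong (A⊆B , B⊆A) = (λ lo y By → lo y (B⊆A By)) , (λ lo y Ay → lo y (A⊆B Ay))

  Up-cong : A ≐ B → Up P A ≐ Up P B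
  Up-cong (A⊆B , B⊆A) = (λ up y By → up y (B⊆A By)) , (λ up y Ay → up y (A⊆B Ay))

  Lo-∪ : Lo P (A ∪ B) ≐ Lo P A ∩ Lo P B
  Lo-∪ = (λ lo → (λ y Ay → lo y (inj₁ Ay)) , (λ y By → lo y (inj₂ By)))
       , (λ (loA , loB) y → Sum.[ loA y , loB y ])

  Up-∪ : Up P (A ∪ B) ≐ Up P A ∩ Up P B
  Up-∪ = (λ up → (λ y Ay → up y (inj₁ Ay)) , (λ y By → up y (inj₂ By)))
       , (λ (upA , upB) y → Sum.[ upA y , upB y ])

  Lo-｛｝ : Lo P ｛ a ｝ ≐ ↓ a
  Lo-｛｝ {a} = (λ lo → lo a refl) , λ { x≤a _ refl → x≤a }

  Up-｛｝ : Up P ｛ a ｝ ≐ ↑ a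
  Up-｛｝ {a} = (λ up → up a refl) , λ { a≤x _ refl → a≤x }

  Lo-↑ : Lo P (↑ a) ≐ ↓ a
  Lo-↑ = (λ lo → lo _ ≤-refl) , (λ x≤a y a≤y → trans x≤a a≤y)

  Up-↓ : Up P (↓ a) ≐ ↑ a
  Up-↓ = (λ up → up _ ≤-refl) , (λ a≤x y y≤a → trans y≤a a≤x)

  pair≐｛｝∪｛｝ : pair P a b ≐ ｛ a ｝ ∪ ｛ b ｝
  pair≐｛｝∪｛｝ = Sum.map ≡-sym ≡-sym , Sum.map ≡-sym ≡-sym

  Lo≐↓-glb : Lo P A m → (∀ l → Lo P A l → l ≤ m) → Lo P A ≐ ↓ m
  Lo≐↓-glb lower greatest =
    greatest _ , (λ x≤m y Ay → trans x≤m (lower y Ay))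

  Lo-∪-principal : Lo P A ≐ ↓ a → Lo P B ≐ ↓ b → Lo P (A ∪ B) ≐ ↓ (a ∧ b)
  Lo-∪-principal {A} {a} {B} {b} LoA LoB = begin
    Lo P (A ∪ B)         ≈⟨ Lo-∪ ⟩
    Lo P A ∩ Lo P B      ≈⟨ ∩-cong LoA LoB ⟩
    ↓ a ∩ ↓ b            ≈⟨ ↓-∩ ⟩
    ↓ (a ∧ b)            ∎

  Up-∪-principal : Up P A ≐ ↑ a → Up P B ≐ ↑ b → Up P (A ∪ B) ≐ ↑ (a ∨ b)
  Up-∪-principal {A} {a} {B} {b} UpA UpB = begin
    Up P (A ∪ B)         ≈⟨ Up-∪ ⟩
    Up P A ∩ Up P B      ≈⟨ ∩-cong UpA UpB ⟩
    ↑ a ∩ ↑ b            ≈⟨ ↑-∩ ⟩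
    ↑ (a ∨ b)            ∎

  Lo-Up-principal : Up P A ≐ ↑ a → Lo P (Up P A) ≐ ↓ a
  Lo-Up-principal {A} {a} UpA = begin
    Lo P (Up P A)        ≈⟨ Lo-cong UpA ⟩
    Lo P (↑ a)           ≈⟨ Lo-↑ ⟩
    ↓ a                  ∎

  Up-Lo-principal : Lo P A ≐ ↓ a → Up P (Lo P A) ≐ ↑ a
  Up-Lo-principal {A} {a} LoA = begin
    Up P (Lo P A)        ≈⟨ Up-cong LoA ⟩
    Up P (↓ a)           ≈⟨ Up-↓ ⟩
    ↑ a                  ∎

  Up-pair : Up P (pair P a b) ≐ ↑ (a ∨ b)
  Up-pair {a} {b} = begin
    Up P (pair P a b)    ≈⟨ Up-cong pair≐｛｝∪｛｝ ⟩
    Up P (｛ a ｝ ∪ ｛ b ｝) ≈⟨ Up-∪-principal Up-｛｝ Up-｛｝ ⟩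
    ↑ (a ∨ b)            ∎

  Lo-pair : Lo P (pair P a b) ≐ ↓ (a ∧ b)
  Lo-pair {a} {b} = begin
    Lo P (pair P a b)    ≈⟨ Lo-cong pair≐｛｝∪｛｝ ⟩
    Lo P (｛ a ｝ ∪ ｛ b ｝) ≈⟨ Lo-∪-principal Lo-｛｝ Lo-｛｝ ⟩
    ↓ (a ∧ b)            ∎

  module _ (modular : IsModular P) where

    strict-modularity₁ : Lo P Z ≐ ↓ m → x ≤ m →
      Lo P (Up P (pair P x y) ∪ Z) ≐ Lo P (Up P (｛ x ｝ ∪ Lo P (｛ y ｝ ∪ Z)))
    strict-modularity₁ {Z} {m} {x} {y} LoZ x≤m = begin
      Lo P (Up P (pair P x y) ∪ Z)         ≈⟨ Lo-∪-principal (Lo-Up-principal Up-pair) LoZ ⟩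
      ↓ ((x ∨ y) ∧ m)                      ≈⟨ ↓-cong (Eq.sym (modular x y m x≤m)) ⟩
      ↓ (x ∨ (y ∧ m))                      ≈⟨ ≐-sym (Lo-Up-principal
                                                (Up-∪-principal Up-｛｝ (Up-Lo-principal (Lo-∪-principal Lo-｛｝ LoZ)))) ⟩
      Lo P (Up P (｛ x ｝ ∪ Lo P (｛ y ｝ ∪ Z))) ∎

    strict-modularity₂ : Lo P X ≐ ↓ m → m ≤ z →
      Lo P (Up P (Lo P X ∪ ｛ y ｝) ∪ ｛ z ｝) ≐ Lo P (Up P (Lo P X ∪ Lo P (pair P y z)))
    strict-modularity₂ {X} {m} {z} {y} LoX m≤z = begin
      Lo P (Up P (Lo P X ∪ ｛ y ｝) ∪ ｛ z ｝) ≈⟨ Lo-∪-principal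
                                                (Lo-Up-principal (Up-∪-principal (Up-Lo-principal LoX) Up-｛｝)) Lo-｛｝ ⟩
      ↓ ((m ∨ y) ∧ z)                      ≈⟨ ↓-cong (Eq.sym (modular m y z m≤z)) ⟩
      ↓ (m ∨ (y ∧ z))                      ≈⟨ ≐-sym (Lo-Up-principal
                                                (Up-∪-principal (Up-Lo-principal LoX) (Up-Lo-principal Lo-pair))) ⟩
      Lo P (Up P (Lo P X ∪ Lo P (pair P y z))) ∎

lemma8 : {ℓ : Level} (P : Lattice ℓ ℓ ℓ) → IsComplete P → IsModular P → IsStrictlyModular P
lemma8 P complete modular =
    (λ x y Z x≤Z →
       let (_ , _ , lower , greatest) = complete Z
           LoZ = Lo≐↓-glb P lower greatest
       in strict-modularity₁ P modular LoZ (proj₁ LoZ x≤Z))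
  , (λ y z X LoX≤z →
       let (_ , _ , lower , greatest) = complete X
           LoX = Lo≐↓-glb P lower greatest
       in strict-modularity₂ P modular LoX (LoX≤z _ (proj₂ LoX (Lattice.refl P))))
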